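{- Let $c$ be a well-formed GCL command and $f$ a label with $\mathsf{okf}(c,f)$, let $pc$ be a variable not occurring in $c$, and let $gcs$ satisfy $c\triangleright_f gcs$ (normal form body for the variable $pc$). Let $n=\mathsf{lab}(c)$. Then $$pc:=n;\ \mathsf{do}\ gcs\ \mathsf{od}\ \cong\ \mathsf{add}^{pc}(c);\ pc:=f .$$
   Context: GCL commands: $c ::= \mathsf{skip}^n \mid x :=^n e \mid c;c \mid \mathsf{if}^n\, gcs\,\mathsf{fi} \mid \mathsf{do}^n\, gcs\,\mathsf{od}$, $gcs ::= e\to c \mid e\to c \,\square\, gcs$, over integer variables, $n\in\mathbb{Z}$ labels, boolean expressions built from primitive boolean expressions by $\wedge,\vee,\neg$. $\mathsf{enab}(gcs)$ is the disjunction of the guards. A command is well formed if well typed and every subcommand $\mathsf{if}^n gcs\,\mathsf{fi}$ has $\mathsf{enab}(gcs)$ true in every store. $\mathsf{lab}(c)$ is the label of $c$ ($\mathsf{lab}(c;d)=\mathsf{lab}(c)$), $\mathsf{labs}(c)$ the set of labels in $c$; $\mathsf{okf}(c,f)$ means all labels in $c$ are positive and pairwise distinct and $f\notin\mathsf{labs}(c)$. Abbreviations for a chosen variable $pc$: $!n$ is the assignment $pc:=n$ (with arbitrary label, e.g. 0) and $?n$ is the boolean expression $pc=n$. Instrumentation $\mathsf{add}^{pc}$: $\mathsf{add}^{pc}(\mathsf{skip}^n)=!n;\mathsf{skip}^n$; $\mathsf{add}^{pc}(x:=^ne)=!n;x:=^ne$; $\mathsf{add}^{pc}(c;d)=\mathsf{add}^{pc}(c);\mathsf{add}^{pc}(d)$;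 $\mathsf{add}^{pc}(\mathsf{if}^n gcs\,\mathsf{fi})=!n;\mathsf{if}^n gcs_0\,\mathsf{fi}$ where $gcs_0$ replaces each $e\to d$ of $gcs$ by $e\to\mathsf{add}^{pc}(d)$; $\mathsf{add}^{pc}(\mathsf{do}^n gcs\,\mathsf{od})=!n;\mathsf{do}^n gcs_1\,\mathsf{od}$ where $gcs_1$ replaces each $e\to d$ by $e\to\mathsf{add}^{pc}(d);!n$. Normal form bodies $c\triangleright_f gcs$ (inductively): $\mathsf{skip}^n\triangleright_f (?n\to !f)$; $x:=^ne\triangleright_f(?n\to x:=e;!f)$; if $c\triangleright_{\mathsf{lab}(d)}gcs_0$ and $d\triangleright_f gcs_1$ then $c;d\triangleright_f gcs_0\,\square\,gcs_1$; for $\mathsf{if}^n gcs\,\mathsf{fi}$ with $gcs=e_1\to d_1\,\square\cdots\square\,e_k\to d_k$ and $d_i\triangleright_f g_i$: $\mathsf{if}^n gcs\,\mathsf{fi}\triangleright_f (?n\wedge e_1\to !\mathsf{lab}(d_1))\square\cdots\square(?n\wedge e_k\to !\mathsf{lab}(d_k))\square g_1\square\cdots\square g_k$; for $\mathsf{do}^n gcs\,\mathsf{od}$ with the same shape and $d_i\triangleright_n g_i$: $\mathsf{do}^n gcs\,\mathsf{od}\triangleright_f (?n\wedge e_1\to !\mathsf{lab}(d_1))\square\cdots\square(?n\wedge e_k\to !\mathsf{lab}(d_k))\square(?n\wedge\neg\mathsf{enab}(gcs)\to !f)\square g_1\square\cdots\square g_k$. Command equivalence $c\cong d$ means $\mathrm{Hyp}\vdash\mathcal{K}(c)=\mathcal{K}(d)$,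 provability in Kleene algebra with tests (KAT): a KAT is $(K,B,+,;,*,\neg,1,0)$ with $B\subseteq K$ a Boolean algebra (with $1$ true, $;$ as conjunction, $+$ disjunction, $\neg$ complement), $K$ an idempotent semiring, and $1+x;x^*=x^*$, $1+x^*;x=x^*$, $y+x;z\le z\Rightarrow x^*;y\le z$, $y+z;x\le z\Rightarrow y;x^*\le z$, where $x\le y$ iff $x+y=y$; $H\vdash E_0=E_1$ means derivable by equational and propositional reasoning from the KAT axioms and the equations $H$. KAT expressions have atoms $\underline{b}$ (primitive boolean expressions, as tests) and $\underline{x:=e}$ (assignments). Translation: $\mathcal{K}(b)=\underline{b}$, $\mathcal{K}(e\wedge e')=\mathcal{K}(e);\mathcal{K}(e')$, $\mathcal{K}(e\vee e')=\mathcal{K}(e)+\mathcal{K}(e')$, $\mathcal{K}(\neg e)=\neg\mathcal{K}(e)$, $\mathcal{K}(x:=e)=\underline{x:=e}$, $\mathcal{K}(\mathsf{skip})=1$, $\mathcal{K}(c;d)=\mathcal{K}(c);\mathcal{K}(d)$, $\mathcal{K}(gcs)=\sum_{e\to c\in gcs}\mathcal{K}(e);\mathcal{K}(c)$, $\mathcal{K}(\mathsf{if}\,gcs\,\mathsf{fi})=\mathcal{K}(gcs)$, $\mathcal{K}(\mathsf{do}\,gcs\,\mathsf{od})=\mathcal{K}(gcs)^*;\neg\mathcal{K}(\mathsf{enab}(gcs))$ (labels ignored). $\mathrm{Hyp}$ is the set of equations $\mathcal{K}(e)=0$ for every boolean expression $e$ that is false in every store, and $\mathcal{K}(e_0);\underline{x:=e};\neg\mathcal{K}(e_1)=0$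 for all $x,e,e_0,e_1$ such that every store satisfying $e_0$ satisfies $e_1$ after updating $x$ to the value of $e$. -}

module Defs where

open import Data.Bool using (Bool; true; false; _∧_; _∨_; not)
open import Data.Nat using (ℕ)
open import Data.Nat.Properties using () renaming (_≟_ to _≟ℕ_)
open import Data.Unit using (⊤)
open import Data.Integer as ℤ using (ℤ; +_)
open import Data.List using (List; []; _∷_; _++_)
open import Data.List.Relation.Unary.All using (All)
open import Data.List.Relation.Unary.Unique.Propositional using (Unique)
open import Data.List.Membership.Propositional using (_∈_)
open import Data.Product using (_×_)
open import Relation.Nullary using (¬_)
open import Relation.Nullary.Decidable using (⌊_⌋)
open import Relation.Binary.PropositionalEquality using (_≡_)

Var : Set
Var = ℕ

Label : Set
Label = ℤ

data IExp : Set where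
  const : ℤ → IExp
  var   : Var → IExp
  _⊕_   : IExp → IExp → IExp
  _⊖_   : IExp → IExp → IExp
  _⊗_   : IExp → IExp → IExp

data PBExp : Set where
  _==_ : IExp → IExp → PBExp
  _<<_ : IExp → IExp → PBExp
  _<=_ : IExp → IExp → PBExp

data BExp : Set where
  prim : PBExp → BExp
  _AND_ : BExp → BExp → BExp
  _OR_  : BExp → BExp → BExp
  NOT   : BExp → BExp

mutual
  data Cmd : Set where
    skip   : Label → Cmd
    assign : Label → Var → IExp → Cmd
    _︔_    : Cmd → Cmd → Cmd
    ifc    : Label → GCs → Cmd
    doc    : Label → GCs → Cmd

  data GCs : Set where
    [_⇒_]   : BExp → Cmd → GCs
    _⇒_□_   : BExp → Cmd → GCs → GCs

infixr 4 _︔_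

_□□_ : GCs → GCs → GCs
[ e ⇒ c ] □□ g = e ⇒ c □ g
(e ⇒ c □ r) □□ g = e ⇒ c □ (r □□ g)

infixr 3 _□□_

enab : GCs → BExp
enab [ e ⇒ c ] = e
enab (e ⇒ c □ r) = e OR enab r

lab : Cmd → Label
lab (skip n) = n
lab (assign n x e) = n
lab (c ︔ d) = lab c
lab (ifc n g) = n
lab (doc n g) = n

mutual
  labs : Cmd → List Label
  labs (skip n) = n ∷ []
  labs (assign n x e) = n ∷ []
  labs (c ︔ d) = labs c ++ labs d
  labs (ifc n g) = n ∷ labsG g
  labs (doc n g) = n ∷ labsG g

  labsG : GCs → List Label
  labsG [ e ⇒ c ] = labs c
  labsG (e ⇒ c □ r) = labs c ++ labsG r

okf : Cmd → Label → Set
okf c f = All (ℤ._<_ (+ 0)) (labs c) × Unique (labs c) × ¬ (f ∈ labs c)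

varsI : IExp → List Var
varsI (const z) = []
varsI (var x) = x ∷ []
varsI (a ⊕ b) = varsI a ++ varsI b
varsI (a ⊖ b) = varsI a ++ varsI b
varsI (a ⊗ b) = varsI a ++ varsI b

varsP : PBExp → List Var
varsP (a == b) = varsI a ++ varsI b
varsP (a << b) = varsI a ++ varsI b
varsP (a <= b) = varsI a ++ varsI b

varsB : BExp → List Var
varsB (prim p) = varsP p
varsB (a AND b) = varsB a ++ varsB b
varsB (a OR b) = varsB a ++ varsB b
varsB (NOT a) = varsB a

mutual
  vars : Cmd → List Var
  vars (skip n) = []
  vars (assign n x e) = x ∷ varsI e
  vars (c ︔ d) = vars c ++ vars d
  vars (ifc n g) = varsG g
  vars (doc n g) = varsG g

  varsG : GCs → List Var
  varsG [ e ⇒ c ] = varsB e ++ vars c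
  varsG (e ⇒ c □ r) = varsB e ++ vars c ++ varsG r

Store : Set
Store = Var → ℤ

update : Store → Var → ℤ → Store
update σ x v y with ⌊ y ≟ℕ x ⌋
... | true  = v
... | false = σ y

evalI : Store → IExp → ℤ
evalI σ (const z) = z
evalI σ (var x) = σ x
evalI σ (a ⊕ b) = evalI σ a ℤ.+ evalI σ b
evalI σ (a ⊖ b) = evalI σ a ℤ.- evalI σ b
evalI σ (a ⊗ b) = evalI σ a ℤ.* evalI σ b

evalP : Store → PBExp → Bool
evalP σ (a == b) = ⌊ evalI σ a ℤ.≟ evalI σ b ⌋
evalP σ (a << b) = ⌊ evalI σ a ℤ.<? evalI σ b ⌋
evalP σ (a <= b) = ⌊ evalI σ a ℤ.≤? evalI σ b ⌋

evalB : Store → BExp → Bool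
evalB σ (prim p) = evalP σ p
evalB σ (a AND b) = evalB σ a ∧ evalB σ b
evalB σ (a OR b) = evalB σ a ∨ evalB σ b
evalB σ (NOT a) = not (evalB σ a)

-- Well-formedness: (well-typedness is built into the syntax) every
-- subcommand if^n gcs fi has enab(gcs) true in every store.

mutual
  WF : Cmd → Set
  WF (skip n) = ⊤
  WF (assign n x e) = ⊤
  WF (c ︔ d) = WF c × WF d
  WF (ifc n g) = (∀ (σ : Store) → evalB σ (enab g) ≡ true) × WFG g
  WF (doc n g) = WFG g

  WFG : GCs → Set
  WFG [ e ⇒ c ] = WF c
  WFG (e ⇒ c □ r) = WF c × WFG r

-- The program-counter abbreviations  !n  and  ?n  (label 0 for !n)

module PC (pc : Var) where

  !_ : Label → Cmd
  ! n = assign (+ 0) pc (const n)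

  ¿_ : Label → BExp
  ¿ n = prim (var pc == const n)

  mutual
    add : Cmd → Cmd
    add (skip n) = ! n ︔ skip n
    add (assign n x e) = ! n ︔ assign n x e
    add (c ︔ d) = add c ︔ add d
    add (ifc n g) = ! n ︔ ifc n (addIf g)
    add (doc n g) = ! n ︔ doc n (addDo n g)

    addIf : GCs → GCs
    addIf [ e ⇒ d ] = [ e ⇒ add d ]
    addIf (e ⇒ d □ r) = e ⇒ add d □ addIf r

    addDo : Label → GCs → GCs
    addDo n [ e ⇒ d ] = [ e ⇒ (add d ︔ ! n) ]
    addDo n (e ⇒ d □ r) = e ⇒ (add d ︔ ! n) □ addDo n r

  heads : Label → GCs → GCs
  heads n [ e ⇒ d ] = [ ((¿ n) AND e) ⇒ ! (lab d) ]
  heads n (e ⇒ d □ r) = ((¿ n) AND e) ⇒ ! (lab d) □ heads n r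

  mutual
    data _▷[_]_ : Cmd → Label → GCs → Set where
      nf-skip   : ∀ {n f} → skip n ▷[ f ] [ ¿ n ⇒ ! f ]
      nf-assign : ∀ {n f x e} →
                  assign n x e ▷[ f ] [ ¿ n ⇒ (assign (+ 0) x e ︔ ! f) ]
      nf-seq    : ∀ {c d f g₀ g₁} →
                  c ▷[ lab d ] g₀ → d ▷[ f ] g₁ → (c ︔ d) ▷[ f ] (g₀ □□ g₁)
      nf-if     : ∀ {n g f gs} →
                  Branches f g gs → ifc n g ▷[ f ] (heads n g □□ gs)
      nf-do     : ∀ {n g f gs} →
                  Branches n g gs →
                  doc n g ▷[ f ] (heads n g □□ (((¿ n) AND NOT (enab g)) ⇒ ! f □ gs))

    data Branches (f : Label) : GCs → GCs → Set where
      br-one  : ∀ {e d g} → d ▷[ f ] g → Branches f [ e ⇒ d ] g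
      br-cons : ∀ {e d r g gs} → d ▷[ f ] g → Branches f r gs →
                Branches f (e ⇒ d □ r) (g □□ gs)

data Test : Set where
  tprim  : PBExp → Test
  ttrue  : Test
  tfalse : Test
  _t∧_   : Test → Test → Test
  _t∨_   : Test → Test → Test
  t¬_    : Test → Test

data KExp : Set where
  tst  : Test → KExp
  asg  : Var → IExp → KExp
  𝟘 𝟙  : KExp
  _+ₖ_ : KExp → KExp → KExp
  _·_  : KExp → KExp → KExp
  _⋆   : KExp → KExp

infixl 6 _+ₖ_
infixl 7 _·_
infix 8 _⋆

module Derivation (H : KExp → KExp → Set) where

  infix 3 _≈_ _≤_

  mutual
    _≤_ : KExp → KExp → Set
    x ≤ y = x +ₖ y ≈ y

    data _≈_ : KExp → KExp → Set where
      hyp   : ∀ {x y} → H x y → x ≈ y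
      refl  : ∀ {x} → x ≈ x
      sym   : ∀ {x y} → x ≈ y → y ≈ x
      trans : ∀ {x y z} → x ≈ y → y ≈ z → x ≈ z
      +-cong : ∀ {x x' y y'} → x ≈ x' → y ≈ y' → x +ₖ y ≈ x' +ₖ y'
      ·-cong : ∀ {x x' y y'} → x ≈ x' → y ≈ y' → x · y ≈ x' · y'
      ⋆-cong : ∀ {x x'} → x ≈ x' → x ⋆ ≈ x' ⋆
      ¬-cong : ∀ {p q} → tst p ≈ tst q → tst (t¬ p) ≈ tst (t¬ q)
      +-assoc : ∀ {x y z} → (x +ₖ y) +ₖ z ≈ x +ₖ (y +ₖ z)
      +-comm  : ∀ {x y} → x +ₖ y ≈ y +ₖ x
      +-idem  : ∀ {x} → x +ₖ x ≈ x
      +-zero  : ∀ {x} → x +ₖ 𝟘 ≈ x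
      ·-assoc : ∀ {x y z} → (x · y) · z ≈ x · (y · z)
      ·-oneˡ  : ∀ {x} → 𝟙 · x ≈ x
      ·-oneʳ  : ∀ {x} → x · 𝟙 ≈ x
      ·-zeroˡ : ∀ {x} → 𝟘 · x ≈ 𝟘
      ·-zeroʳ : ∀ {x} → x · 𝟘 ≈ 𝟘
      distribˡ : ∀ {x y z} → x · (y +ₖ z) ≈ x · y +ₖ x · z
      distribʳ : ∀ {x y z} → (x +ₖ y) · z ≈ x · z +ₖ y · z
      t-true  : tst ttrue ≈ 𝟙
      t-false : tst tfalse ≈ 𝟘
      t-and   : ∀ {p q} → tst (p t∧ q) ≈ tst p · tst q
      t-or    : ∀ {p q} → tst (p t∨ q) ≈ tst p +ₖ tst q
      t-comm  : ∀ {p q} → tst p · tst q ≈ tst q · tst p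
      t-idem  : ∀ {p} → tst p · tst p ≈ tst p
      t-compl+ : ∀ {p} → tst p +ₖ tst (t¬ p) ≈ 𝟙
      t-compl· : ∀ {p} → tst p · tst (t¬ p) ≈ 𝟘
      ⋆-unfoldˡ : ∀ {x} → 𝟙 +ₖ x · x ⋆ ≈ x ⋆
      ⋆-unfoldʳ : ∀ {x} → 𝟙 +ₖ x ⋆ · x ≈ x ⋆
      ⋆-indˡ : ∀ {x y z} → y +ₖ x · z ≤ z → x ⋆ · y ≤ z
      ⋆-indʳ : ∀ {x y z} → y +ₖ z · x ≤ z → y · x ⋆ ≤ z

KB : BExp → Test
KB (prim p) = tprim p
KB (a AND b) = KB a t∧ KB b
KB (a OR b) = KB a t∨ KB b
KB (NOT a) = t¬ KB a

mutual
  KC : Cmd → KExp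
  KC (skip n) = 𝟙
  KC (assign n x e) = asg x e
  KC (c ︔ d) = KC c · KC d
  KC (ifc n g) = KG g
  KC (doc n g) = KG g ⋆ · tst (t¬ KB (enab g))

  KG : GCs → KExp
  KG [ e ⇒ c ] = tst (KB e) · KC c
  KG (e ⇒ c □ r) = tst (KB e) · KC c +ₖ KG r

data Hyp : KExp → KExp → Set where
  hyp-false : (e : BExp) → (∀ (σ : Store) → evalB σ e ≡ false) →
              Hyp (tst (KB e)) 𝟘
  hyp-asg   : (x : Var) (e : IExp) (e₀ e₁ : BExp) →
              (∀ (σ : Store) → evalB σ e₀ ≡ true →
                 evalB (update σ x (evalI σ e)) e₁ ≡ true) →
              Hyp (tst (KB e₀) · asg x e · tst (t¬ KB e₁)) 𝟘

_≅_ : Cmd → Cmd → Set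
c ≅ d = Derivation._≈_ Hyp (KC c) (KC d)

infix 2 _≅_

-- Write !m for pc := m.  By induction on the derivation of c ▷_f gcs one proves the
-- local statement  !lab(c); do gcs od ≅ add(c); !f  for every subcommand c.  Every guard
-- of gcs tests pc against a label of c, and every branch ends by setting pc to a label of
-- c or to f; as the labels are distinct and differ from f, the hypotheses Hyp show which
-- guarded commands can fire after which.  For c;d the loop factors as gcs₀⋆ gcs₁⋆, since
-- no command of gcs₀ fires after one of gcs₁.  For if and do, denesting separates the
-- head commands ?n ∧ eᵢ → !lab(dᵢ) from the normal forms of the branches, and the
-- induction hypothesis for dᵢ, which still holds inside the larger loop because the
-- foreign guards stay disabled, turns each head followed by its branch into eᵢ → add(dᵢ).

module Submission where

open import Data.Bool using (true; false; _∧_; _∨_; not)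
open import Data.Bool.Properties using (∨-assoc; ∧-distribˡ-∨; ∨-∧-booleanAlgebra)
open import Algebra.Lattice.Properties.BooleanAlgebra ∨-∧-booleanAlgebra using (deMorgan₂)
open import Data.Empty using (⊥-elim)
open import Data.Integer as ℤ using (+_)
open import Data.List using (List; []; _∷_; _++_)
open import Data.List.Membership.Propositional using (_∈_; _∉_)
open import Data.List.Membership.Propositional.Properties using (∈-++⁺ˡ; ∈-++⁺ʳ; ∈-++⁻)
open import Data.List.Relation.Binary.Disjoint.Propositional using (Disjoint)
open import Data.List.Relation.Binary.Subset.Propositional using (_⊆_)
import Data.List.Relation.Unary.All as All
import Data.List.Relation.Unary.All.Properties as Allₚ
open import Data.List.Relation.Unary.Any using (here; there)
open import Data.List.Relation.Unary.Unique.Propositional using (Unique; []; _∷_)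
open import Data.List.Relation.Unary.Unique.Propositional.Properties using (Unique[x∷xs]⇒x∉xs)
open import Data.Nat.Properties using () renaming (_≟_ to _≟ℕ_)
open import Data.Product using (_×_; _,_; ∃-syntax)
open import Data.Sum using (_⊎_; inj₁; inj₂)
open import Relation.Binary.Bundles using (Setoid)
open import Relation.Binary.PropositionalEquality as ≡ using (_≡_; _≢_; refl)
import Relation.Binary.Reasoning.Setoid as SetoidReasoning
open import Relation.Nullary using (¬_; yes; no)

open import Defs

module KAT (H : KExp → KExp → Set) where

  open Derivation H public

  ≈-setoid : Setoid _ _
  ≈-setoid = record
    { Carrier = KExp
    ; _≈_ = _≈_
    ; isEquivalence = record { refl = refl ; sym = sym ; trans = trans }
    }

  open SetoidReasoning ≈-setoid public using (begin_; _∎; step-≈-⟩; step-≈-⟨)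

  infixr 2 _⟫_

  _⟫_ : ∀ {x y z} → x ≈ y → y ≈ z → x ≈ z
  _⟫_ = trans

  ≡⇒≈ : ∀ {x y} → x ≡ y → x ≈ y
  ≡⇒≈ refl = refl

  ·-congˡ : ∀ {x y y'} → y ≈ y' → x · y ≈ x · y'
  ·-congˡ = ·-cong refl

  ·-congʳ : ∀ {x x' y} → x ≈ x' → x · y ≈ x' · y
  ·-congʳ p = ·-cong p refl

  +-congˡ : ∀ {x y y'} → y ≈ y' → x +ₖ y ≈ x +ₖ y'
  +-congˡ = +-cong refl

  +-congʳ : ∀ {x x' y} → x ≈ x' → x +ₖ y ≈ x' +ₖ y
  +-congʳ p = +-cong p refl

  +-identityˡ : ∀ {x} → 𝟘 +ₖ x ≈ x
  +-identityˡ = +-comm ⟫ +-zero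

  ≤-refl : ∀ {x} → x ≤ x
  ≤-refl = +-idem

  ≈⇒≤ : ∀ {x y} → x ≈ y → x ≤ y
  ≈⇒≤ p = +-congˡ (sym p) ⟫ +-idem ⟫ p

  ≤-resp-≈ : ∀ {x x' y y'} → x ≈ x' → y ≈ y' → x ≤ y → x' ≤ y'
  ≤-resp-≈ p q r = +-cong (sym p) (sym q) ⟫ r ⟫ q

  ≤-trans : ∀ {x y z} → x ≤ y → y ≤ z → x ≤ z
  ≤-trans p q = +-congˡ (sym q) ⟫ sym +-assoc ⟫ +-congʳ p ⟫ q

  ≤-antisym : ∀ {x y} → x ≤ y → y ≤ x → x ≈ y
  ≤-antisym p q = sym q ⟫ +-comm ⟫ p

  x≤x+y : ∀ {x y} → x ≤ x +ₖ y
  x≤x+y = sym +-assoc ⟫ +-congʳ +-idem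

  y≤x+y : ∀ {x y} → y ≤ x +ₖ y
  y≤x+y = ≤-resp-≈ refl +-comm x≤x+y

  +-lub : ∀ {x y z} → x ≤ z → y ≤ z → x +ₖ y ≤ z
  +-lub p q = +-assoc ⟫ +-congˡ q ⟫ p

  ·-monoʳ-≤ : ∀ {z x y} → x ≤ y → z · x ≤ z · y
  ·-monoʳ-≤ p = sym distribˡ ⟫ ·-congˡ p

  ·-monoˡ-≤ : ∀ {z x y} → x ≤ y → x · z ≤ y · z
  ·-monoˡ-≤ p = sym distribʳ ⟫ ·-congʳ p

  ·-mono-≤ : ∀ {x x' y y'} → x ≤ x' → y ≤ y' → x · y ≤ x' · y'
  ·-mono-≤ p q = ≤-trans (·-monoˡ-≤ p) (·-monoʳ-≤ q)

  test≤𝟙 : ∀ {p} → tst p ≤ 𝟙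
  test≤𝟙 = +-congˡ (sym t-compl+) ⟫ sym +-assoc ⟫ +-congʳ +-idem ⟫ t-compl+

  test·x≤x : ∀ {p x} → tst p · x ≤ x
  test·x≤x = ≤-resp-≈ refl ·-oneˡ (·-monoˡ-≤ test≤𝟙)

  x·test≤x : ∀ {p x} → x · tst p ≤ x
  x·test≤x = ≤-resp-≈ refl ·-oneʳ (·-monoʳ-≤ test≤𝟙)

  𝟙≤x⋆ : ∀ {x} → 𝟙 ≤ x ⋆
  𝟙≤x⋆ = ≤-resp-≈ refl ⋆-unfoldˡ x≤x+y

  x·x⋆≤x⋆ : ∀ {x} → x · x ⋆ ≤ x ⋆
  x·x⋆≤x⋆ = ≤-resp-≈ refl ⋆-unfoldˡ y≤x+y

  x⋆·x≤x⋆ : ∀ {x} → x ⋆ · x ≤ x ⋆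
  x⋆·x≤x⋆ = ≤-resp-≈ refl ⋆-unfoldʳ y≤x+y

  x≤x⋆ : ∀ {x} → x ≤ x ⋆
  x≤x⋆ = ≤-trans (≈⇒≤ (sym ·-oneʳ)) (≤-trans (·-monoʳ-≤ 𝟙≤x⋆) x·x⋆≤x⋆)

  y≤y·x⋆ : ∀ {y x} → y ≤ y · x ⋆
  y≤y·x⋆ = ≤-trans (≈⇒≤ (sym ·-oneʳ)) (·-monoʳ-≤ 𝟙≤x⋆)

  y·x⋆·x≤y·x⋆ : ∀ {y x} → (y · x ⋆) · x ≤ y · x ⋆
  y·x⋆·x≤y·x⋆ = ≤-resp-≈ (sym ·-assoc) refl (·-monoʳ-≤ x⋆·x≤x⋆)

  x⋆·x⋆≤x⋆ : ∀ {x} → x ⋆ · x ⋆ ≤ x ⋆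
  x⋆·x⋆≤x⋆ = ⋆-indˡ (+-lub ≤-refl x·x⋆≤x⋆)

  x≤y⋆⇒x⋆≤y⋆ : ∀ {x y} → x ≤ y ⋆ → x ⋆ ≤ y ⋆
  x≤y⋆⇒x⋆≤y⋆ p =
    ≤-resp-≈ ·-oneʳ refl (⋆-indˡ (+-lub 𝟙≤x⋆ (≤-trans (·-monoˡ-≤ p) x⋆·x⋆≤x⋆)))

  ⋆-mono-≤ : ∀ {x y} → x ≤ y → x ⋆ ≤ y ⋆
  ⋆-mono-≤ p = x≤y⋆⇒x⋆≤y⋆ (≤-trans p x≤x⋆)

  x·y≈𝟘⇒x·y⋆≈x : ∀ {x y} → x · y ≈ 𝟘 → x · y ⋆ ≈ x
  x·y≈𝟘⇒x·y⋆≈x {x} {y} p = begin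
    x · y ⋆                ≈⟨ ·-congˡ (sym ⋆-unfoldˡ) ⟩
    x · (𝟙 +ₖ y · y ⋆)     ≈⟨ distribˡ ⟩
    x · 𝟙 +ₖ x · (y · y ⋆) ≈⟨ +-cong ·-oneʳ (sym ·-assoc) ⟩
    x +ₖ (x · y) · y ⋆     ≈⟨ +-congˡ (·-congʳ p ⟫ ·-zeroˡ) ⟩
    x +ₖ 𝟘                 ≈⟨ +-zero ⟩
    x                      ∎

  x·y≈𝟘⇒x⋆·y≈y : ∀ {x y} → x · y ≈ 𝟘 → x ⋆ · y ≈ y
  x·y≈𝟘⇒x⋆·y≈y p = ·-congʳ (sym ⋆-unfoldʳ) ⟫ distribʳ
    ⟫ +-cong ·-oneˡ (·-assoc ⟫ ·-congˡ p ⟫ ·-zeroʳ) ⟫ +-zero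

  x·x≈𝟘⇒x⋆≈𝟙+x : ∀ {x} → x · x ≈ 𝟘 → x ⋆ ≈ 𝟙 +ₖ x
  x·x≈𝟘⇒x⋆≈𝟙+x p = sym ⋆-unfoldˡ ⟫ +-congˡ (x·y≈𝟘⇒x·y⋆≈x p)

  y·x≈𝟘⇒[x+y]⋆≈x⋆·y⋆ : ∀ {x y} → y · x ≈ 𝟘 → (x +ₖ y) ⋆ ≈ x ⋆ · y ⋆
  y·x≈𝟘⇒[x+y]⋆≈x⋆·y⋆ {x} {y} p = ≤-antisym le ge
    where
    y·x⋆·y⋆≤y⋆ : y · (x ⋆ · y ⋆) ≤ y ⋆
    y·x⋆·y⋆≤y⋆ = ≤-resp-≈ (·-congʳ (sym (x·y≈𝟘⇒x·y⋆≈x p)) ⟫ ·-assoc) refl x·x⋆≤x⋆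
    le : (x +ₖ y) ⋆ ≤ x ⋆ · y ⋆
    le = ≤-resp-≈ ·-oneʳ refl (⋆-indˡ (+-lub
          (≤-resp-≈ ·-oneˡ refl (·-mono-≤ 𝟙≤x⋆ 𝟙≤x⋆))
          (≤-resp-≈ (sym distribʳ) refl (+-lub
             (≤-resp-≈ ·-assoc refl (·-monoˡ-≤ x·x⋆≤x⋆))
             (≤-trans y·x⋆·y⋆≤y⋆ (≤-resp-≈ ·-oneˡ refl (·-monoˡ-≤ 𝟙≤x⋆)))))))
    ge : x ⋆ · y ⋆ ≤ (x +ₖ y) ⋆
    ge = ≤-trans (·-mono-≤ (⋆-mono-≤ x≤x+y) (⋆-mono-≤ y≤x+y)) x⋆·x⋆≤x⋆

  ·-comm⇒·⋆-comm : ∀ {t x} → t · x ≈ x · t → t · x ⋆ ≈ x ⋆ · t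
  ·-comm⇒·⋆-comm {t} {x} p = ≤-antisym le ge
    where
    le : t · x ⋆ ≤ x ⋆ · t
    le = ⋆-indʳ (+-lub (≤-resp-≈ ·-oneˡ refl (·-monoˡ-≤ 𝟙≤x⋆))
          (≤-resp-≈ (sym (·-assoc ⟫ ·-congˡ p ⟫ sym ·-assoc)) refl (·-monoˡ-≤ x⋆·x≤x⋆)))
    ge : x ⋆ · t ≤ t · x ⋆
    ge = ⋆-indˡ (+-lub (≤-resp-≈ ·-oneʳ refl (·-monoʳ-≤ 𝟙≤x⋆))
          (≤-resp-≈ (sym (sym ·-assoc ⟫ ·-congʳ (sym p) ⟫ ·-assoc)) refl (·-monoʳ-≤ x·x⋆≤x⋆)))

  -- As y is never followed by z, every run of (x + z)⋆ after y is a sequence of blocks x z⋆.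
  ⋆-denest : ∀ {y x z} → y · z ≈ 𝟘 → y · (x +ₖ z) ⋆ ≈ y · (x · z ⋆) ⋆
  ⋆-denest {y} {x} {z} p = ≤-antisym le ge
    where
    U = (x · z ⋆) ⋆
    ge : y · U ≤ y · (x +ₖ z) ⋆
    ge = ·-monoʳ-≤ (x≤y⋆⇒x⋆≤y⋆ (≤-trans (·-mono-≤ (≤-trans x≤x+y x≤x⋆) (⋆-mono-≤ y≤x+y)) x⋆·x⋆≤x⋆))
    yU≈yUxz⋆ : (y · U) · z ≈ (y · (U · x · z ⋆)) · z
    yU≈yUxz⋆ = begin
      (y · U) · z                    ≈⟨ ·-congʳ (·-congˡ (sym ⋆-unfoldʳ)) ⟩
      (y · (𝟙 +ₖ U · (x · z ⋆))) · z ≈⟨ ·-congʳ (distribˡ ⟫ +-congʳ ·-oneʳ) ⟩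
      (y +ₖ y · (U · (x · z ⋆))) · z ≈⟨ distribʳ ⟫ +-congʳ p ⟫ +-identityˡ ⟩
      (y · (U · (x · z ⋆))) · z      ≈⟨ ·-congʳ (·-congˡ (sym ·-assoc)) ⟩
      (y · (U · x · z ⋆)) · z        ∎
    yUz≤yU : (y · U) · z ≤ y · U
    yUz≤yU = ≤-resp-≈ (sym yU≈yUxz⋆) refl
      (≤-trans (≤-resp-≈ (sym (·-assoc ⟫ ·-congˡ ·-assoc)) refl (·-monoʳ-≤ (·-monoʳ-≤ x⋆·x≤x⋆)))
        (·-monoʳ-≤ (≤-resp-≈ (sym ·-assoc) refl x⋆·x≤x⋆)))
    yUx≤yU : (y · U) · x ≤ y · U
    yUx≤yU = ≤-trans (·-monoʳ-≤ (y≤y·x⋆ {x} {z})) (≤-resp-≈ (sym ·-assoc) refl (·-monoʳ-≤ x⋆·x≤x⋆))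
    le : y · (x +ₖ z) ⋆ ≤ y · U
    le = ⋆-indʳ (+-lub y≤y·x⋆ (≤-resp-≈ (sym distribˡ) refl (+-lub yUx≤yU yUz≤yU)))

  Ensures : KExp → Test → Set
  Ensures x p = x ≈ x · tst p

  x≈x·p+x·¬p : ∀ {x p} → x ≈ x · tst p +ₖ x · tst (t¬ p)
  x≈x·p+x·¬p = sym ·-oneʳ ⟫ ·-congˡ (sym t-compl+) ⟫ distribˡ

  ensures-annihilates : ∀ {x y p} → Ensures x p → tst p · y ≈ 𝟘 → x · y ≈ 𝟘
  ensures-annihilates hx hy = ·-congʳ hx ⟫ ·-assoc ⟫ ·-congˡ hy ⟫ ·-zeroʳ

  ·⋆-ensures : ∀ {y x p} → Ensures y p → Ensures x p → Ensures (y · x ⋆) p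
  ·⋆-ensures {y} {x} {p} hy hx = ≤-antisym le x·test≤x
    where
    le : y · x ⋆ ≤ (y · x ⋆) · tst p
    le = ⋆-indʳ (+-lub (≤-resp-≈ (sym hy) refl (·-monoˡ-≤ y≤y·x⋆))
          (≤-trans (≤-resp-≈ (sym ·-assoc) refl (·-monoʳ-≤ test·x≤x))
            (≤-resp-≈ (sym (·-congˡ hx ⟫ sym ·-assoc)) refl (·-monoˡ-≤ y·x⋆·x≤y·x⋆))))

  ⋆-drop-disabled : ∀ {y x w r p} → Ensures y p → Ensures x p → w ≈ x +ₖ r →
                    tst p · r ≈ 𝟘 → y · w ⋆ ≈ y · x ⋆
  ⋆-drop-disabled {y} {x} {w} {r} {p} hy hx hw hr = ≤-antisym le ge
    where
    post : Ensures (y · x ⋆) p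
    post = ·⋆-ensures hy hx
    step : (y · x ⋆) · w ≈ (y · x ⋆) · x
    step = begin
      (y · x ⋆) · w                        ≈⟨ ·-cong post hw ⟩
      ((y · x ⋆) · tst p) · (x +ₖ r)       ≈⟨ ·-assoc ⟫ ·-congˡ distribˡ ⟩
      (y · x ⋆) · (tst p · x +ₖ tst p · r) ≈⟨ ·-congˡ (+-congˡ hr ⟫ +-zero) ⟩
      (y · x ⋆) · (tst p · x)              ≈⟨ sym ·-assoc ⟫ ·-congʳ (sym post) ⟩
      (y · x ⋆) · x                        ∎
    le : y · w ⋆ ≤ y · x ⋆
    le = ⋆-indʳ (+-lub y≤y·x⋆ (≤-resp-≈ (sym step) refl y·x⋆·x≤y·x⋆))
    ge : y · x ⋆ ≤ y · w ⋆
    ge = ·-monoʳ-≤ (⋆-mono-≤ (≤-resp-≈ refl (sym hw) x≤x+y))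

  ⋆-drop-test : ∀ {y x p} → Ensures y p → Ensures x p → y · (tst p · x) ⋆ ≈ y · x ⋆
  ⋆-drop-test {y} {x} {p} hy hx = ≤-antisym (·-monoʳ-≤ (⋆-mono-≤ test·x≤x)) ge
    where
    post : Ensures (y · (tst p · x) ⋆) p
    post = ·⋆-ensures hy (·-congˡ hx ⟫ sym ·-assoc)
    ge : y · x ⋆ ≤ y · (tst p · x) ⋆
    ge = ⋆-indʳ (+-lub y≤y·x⋆ (≤-resp-≈ (sym (·-congʳ post ⟫ ·-assoc)) refl y·x⋆·x≤y·x⋆))

  ⋆-insert-test : ∀ {x y p} → x · y ≈ (x · tst p) · y → x · x ≈ (x · tst p) · x →
                  x ⋆ · y ≈ (x · tst p) ⋆ · y
  ⋆-insert-test {x} {y} {p} hy hx = ≤-antisym le ge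
    where
    z = (x · tst p) ⋆ · y
    unfold : z ≈ y +ₖ (x · tst p) · z
    unfold = ·-congʳ (sym ⋆-unfoldˡ) ⟫ distribʳ ⟫ +-cong ·-oneˡ ·-assoc
    xz≈xpz : x · z ≈ (x · tst p) · z
    xz≈xpz = begin
      x · z
        ≈⟨ ·-congˡ unfold ⟫ distribˡ ⟩
      x · y +ₖ x · ((x · tst p) · z)
        ≈⟨ +-cong hy (sym ·-assoc ⟫ ·-congʳ (sym ·-assoc ⟫ ·-congʳ hx)) ⟩
      (x · tst p) · y +ₖ (((x · tst p) · x) · tst p) · z
        ≈⟨ +-congˡ (·-congʳ ·-assoc ⟫ ·-assoc) ⟩
      (x · tst p) · y +ₖ (x · tst p) · ((x · tst p) · z)
        ≈⟨ sym distribˡ ⟫ ·-congˡ (sym unfold) ⟩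
      (x · tst p) · z ∎
    le : x ⋆ · y ≤ z
    le = ⋆-indˡ (+-lub (≤-resp-≈ refl (sym unfold) x≤x+y) (≤-resp-≈ (sym xz≈xpz) (sym unfold) y≤x+y))
    ge : z ≤ x ⋆ · y
    ge = ·-monoˡ-≤ (⋆-mono-≤ x·test≤x)

  ensures-insert-test : ∀ {y x p q} → Ensures y p → (tst p · tst (t¬ q)) · x ≈ 𝟘 →
                        y · x ≈ (y · tst q) · x
  ensures-insert-test {y} {x} {p} {q} hy h = begin
    y · x
      ≈⟨ ·-congʳ (hy ⟫ ·-congˡ x≈x·p+x·¬p) ⟩
    (y · (tst p · tst q +ₖ tst p · tst (t¬ q))) · x
      ≈⟨ ·-congʳ distribˡ ⟫ distribʳ ⟩
    (y · (tst p · tst q)) · x +ₖ (y · (tst p · tst (t¬ q))) · x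
      ≈⟨ +-congˡ (·-assoc ⟫ ·-congˡ h ⟫ ·-zeroʳ) ⟫ +-zero ⟩
    (y · (tst p · tst q)) · x
      ≈⟨ ·-congʳ (sym ·-assoc ⟫ ·-congʳ (sym hy)) ⟩
    (y · tst q) · x ∎

open KAT Hyp

∨-trueˡ : ∀ {x} y → x ≡ true → x ∨ y ≡ true
∨-trueˡ y refl = refl

∨-trueʳ : ∀ x {y} → y ≡ true → x ∨ y ≡ true
∨-trueʳ true  _ = refl
∨-trueʳ false p = p

∨-true⁻ : ∀ x y → x ∨ y ≡ true → x ≡ true ⊎ y ≡ true
∨-true⁻ true  y _ = inj₁ refl
∨-true⁻ false y p = inj₂ p

∧-true : ∀ {x y} → x ≡ true → y ≡ true → x ∧ y ≡ true
∧-true refl refl = refl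

∧-true⁻ˡ : ∀ x {y} → x ∧ y ≡ true → x ≡ true
∧-true⁻ˡ true _ = refl

∧-true⁻ʳ : ∀ x {y} → x ∧ y ≡ true → y ≡ true
∧-true⁻ʳ true p = p

not-false : ∀ {x} → x ≡ false → not x ≡ true
not-false refl = refl

not-true : ∀ {x} → x ≡ true → not x ≡ false
not-true refl = refl

not-true⁻ : ∀ {x} → not x ≡ true → x ≡ false
not-true⁻ {false} _ = refl

¬true⇒false : ∀ {x} → ¬ x ≡ true → x ≡ false
¬true⇒false {true}  p = ⊥-elim (p refl)
¬true⇒false {false} _ = refl

true⇒¬false : ∀ {x} → x ≡ true → ¬ x ≡ false
true⇒¬false refl ()

infix 4 _⊨_

_⊨_ : Store → BExp → Set
σ ⊨ e = evalB σ e ≡ true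

T : BExp → KExp
T e = tst (KB e)

always : BExp
always = prim (const (+ 0) == const (+ 0))

never⇒T≈𝟘 : ∀ {e} → (∀ σ → evalB σ e ≡ false) → T e ≈ 𝟘
never⇒T≈𝟘 {e} h = hyp (hyp-false e h)

exclusive⇒T·T≈𝟘 : ∀ {a b} → (∀ σ → σ ⊨ a → evalB σ b ≡ false) → T a · T b ≈ 𝟘
exclusive⇒T·T≈𝟘 {a} {b} h = sym t-and ⟫ never⇒T≈𝟘 {a AND b} (λ σ → ∧-false (h σ))
  where
  ∧-false : ∀ {x y} → (x ≡ true → y ≡ false) → x ∧ y ≡ false
  ∧-false {true}  p = p refl
  ∧-false {false} _ = refl

entails⇒ensures : ∀ {a b} → (∀ σ → σ ⊨ a → σ ⊨ b) → Ensures (T a) (KB b)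
entails⇒ensures {a} {b} h =
  x≈x·p+x·¬p ⟫ +-congˡ (exclusive⇒T·T≈𝟘 {a} {NOT b} (λ σ p → not-true (h σ p))) ⟫ +-zero

entails⇒absorbs : ∀ {a b} → (∀ σ → σ ⊨ a → σ ⊨ b) → T b · T a ≈ T a
entails⇒absorbs h = sym (entails⇒ensures h ⟫ t-comm)

equivalent⇒T≈T : ∀ {a b} → (∀ σ → evalB σ a ≡ evalB σ b) → T a ≈ T b
equivalent⇒T≈T {a} {b} h =
  entails⇒ensures {a} {b} (λ σ p → ≡.trans (≡.sym (h σ)) p)
  ⟫ entails⇒absorbs {b} {a} (λ σ p → ≡.trans (h σ) p)

T-always≈𝟙 : T always ≈ 𝟙
T-always≈𝟙 = sym +-zero ⟫ +-congˡ (sym (never⇒T≈𝟘 {NOT always} (λ σ → refl))) ⟫ t-compl+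

asg-ensures : ∀ {x e b} → (∀ σ → update σ x (evalI σ e) ⊨ b) → Ensures (asg x e) (KB b)
asg-ensures {x} {e} {b} h = begin
  asg x e
    ≈⟨ sym ·-oneˡ ⟫ ·-congʳ (sym T-always≈𝟙) ⟩
  T always · asg x e
    ≈⟨ x≈x·p+x·¬p ⟩
  (T always · asg x e) · T b +ₖ (T always · asg x e) · T (NOT b)
    ≈⟨ +-congˡ (hyp (hyp-asg x e always b (λ σ _ → h σ))) ⟫ +-zero ⟩
  (T always · asg x e) · T b
    ≈⟨ ·-congʳ (·-congʳ T-always≈𝟙 ⟫ ·-oneˡ) ⟩
  asg x e · T b ∎

update-same : ∀ σ x v → update σ x v x ≡ v
update-same σ x v with x ≟ℕ x
... | yes _ = refl
... | no x≢x = ⊥-elim (x≢x refl)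

AllGC : (BExp → Cmd → Set) → GCs → Set
AllGC P [ e ⇒ c ]   = P e c
AllGC P (e ⇒ c □ r) = P e c × AllGC P r

AllGC-□□ : ∀ {P} g h → AllGC P g → AllGC P h → AllGC P (g □□ h)
AllGC-□□ [ e ⇒ c ]   h pg       ph = pg , ph
AllGC-□□ (e ⇒ c □ r) h (p , pr) ph = p , AllGC-□□ r h pr ph

AllGC-map : ∀ {P Q : BExp → Cmd → Set} → (∀ {e c} → P e c → Q e c) →
            ∀ g → AllGC P g → AllGC Q g
AllGC-map f [ e ⇒ c ]   p        = f p
AllGC-map f (e ⇒ c □ r) (p , pr) = f p , AllGC-map f r pr

KG-□□ : ∀ g h → KG (g □□ h) ≈ KG g +ₖ KG h
KG-□□ [ e ⇒ c ]   h = refl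
KG-□□ (e ⇒ c □ r) h = +-congˡ (KG-□□ r h) ⟫ sym +-assoc

enab-□□ : ∀ σ g h → evalB σ (enab (g □□ h)) ≡ evalB σ (enab g) ∨ evalB σ (enab h)
enab-□□ σ [ e ⇒ c ]   h = refl
enab-□□ σ (e ⇒ c □ r) h rewrite enab-□□ σ r h =
  ≡.sym (∨-assoc (evalB σ e) (evalB σ (enab r)) (evalB σ (enab h)))

enab-□□⁺ˡ : ∀ σ g h → σ ⊨ enab g → σ ⊨ enab (g □□ h)
enab-□□⁺ˡ σ g h p = ≡.trans (enab-□□ σ g h) (∨-trueˡ _ p)

enab-□□⁺ʳ : ∀ σ g h → σ ⊨ enab h → σ ⊨ enab (g □□ h)
enab-□□⁺ʳ σ g h p = ≡.trans (enab-□□ σ g h) (∨-trueʳ (evalB σ (enab g)) p)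

guards⇒enab : ∀ g → AllGC (λ e _ → ∀ σ → σ ⊨ e → σ ⊨ enab g) g
guards⇒enab [ e ⇒ c ]   = λ σ p → p
guards⇒enab (e ⇒ c □ r) = (λ σ p → ∨-trueˡ _ p) ,
  AllGC-map (λ h σ p → ∨-trueʳ (evalB σ e) (h σ p)) r (guards⇒enab r)

guards-entail⇒T·KG≈KG : ∀ {t} g → AllGC (λ e _ → ∀ σ → σ ⊨ e → σ ⊨ t) g → T t · KG g ≈ KG g
guards-entail⇒T·KG≈KG [ e ⇒ c ]   h        = sym ·-assoc ⟫ ·-congʳ (entails⇒absorbs h)
guards-entail⇒T·KG≈KG (e ⇒ c □ r) (h , hr) =
  distribˡ ⟫ +-cong (sym ·-assoc ⟫ ·-congʳ (entails⇒absorbs h)) (guards-entail⇒T·KG≈KG r hr)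

guards-exclude⇒T·KG≈𝟘 : ∀ {t} g → AllGC (λ e _ → ∀ σ → σ ⊨ t → evalB σ e ≡ false) g →
                         T t · KG g ≈ 𝟘
guards-exclude⇒T·KG≈𝟘 [ e ⇒ c ]   h        = sym ·-assoc ⟫ ·-congʳ (exclusive⇒T·T≈𝟘 h) ⟫ ·-zeroˡ
guards-exclude⇒T·KG≈𝟘 (e ⇒ c □ r) (h , hr) =
  distribˡ ⟫ +-cong (sym ·-assoc ⟫ ·-congʳ (exclusive⇒T·T≈𝟘 h) ⟫ ·-zeroˡ) (guards-exclude⇒T·KG≈𝟘 r hr)
  ⟫ +-zero

¬enab·KG≈𝟘 : ∀ g → T (NOT (enab g)) · KG g ≈ 𝟘
¬enab·KG≈𝟘 g = guards-exclude⇒T·KG≈𝟘 g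
  (AllGC-map (λ h σ p → ¬true⇒false (λ q → true⇒¬false (h σ q) (not-true⁻ p))) g (guards⇒enab g))

lab∈labs : ∀ c → lab c ∈ labs c
lab∈labs (skip n)       = here refl
lab∈labs (assign n x e) = here refl
lab∈labs (c ︔ d)        = ∈-++⁺ˡ (lab∈labs c)
lab∈labs (ifc n g)      = here refl
lab∈labs (doc n g)      = here refl

Unique-++⁻ˡ : ∀ {A : Set} (xs : List A) {ys} → Unique (xs ++ ys) → Unique xs
Unique-++⁻ˡ []       _       = []
Unique-++⁻ˡ (x ∷ xs) (a ∷ u) = Allₚ.++⁻ˡ xs a ∷ Unique-++⁻ˡ xs u

Unique-++⁻ʳ : ∀ {A : Set} (xs : List A) {ys} → Unique (xs ++ ys) → Unique ys
Unique-++⁻ʳ []       u       = u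
Unique-++⁻ʳ (x ∷ xs) (_ ∷ u) = Unique-++⁻ʳ xs u

Unique-++⇒Disjoint : ∀ {A : Set} (xs : List A) {ys} → Unique (xs ++ ys) → Disjoint xs ys
Unique-++⇒Disjoint (x ∷ xs) (a ∷ u) (here refl , q) = All.lookup (Allₚ.++⁻ʳ xs a) q refl
Unique-++⇒Disjoint (x ∷ xs) (a ∷ u) (there p , q)   = Unique-++⇒Disjoint xs u (p , q)

module ProgramCounter (pc : Var) where

  open PC pc

  !ₖ : Label → KExp
  !ₖ m = KC (! m)

  ¿-sound : ∀ σ m → σ ⊨ (¿ m) → σ pc ≡ m
  ¿-sound σ m h with σ pc ℤ.≟ m
  ... | yes p = p
  ¿-sound σ m () | no _

  ¿-complete : ∀ σ m → σ pc ≡ m → σ ⊨ (¿ m)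
  ¿-complete σ m p with σ pc ℤ.≟ m
  ... | yes _  = refl
  ... | no pc≢m = ⊥-elim (pc≢m p)

  ¿-exclusive : ∀ {m n} → m ≢ n → ∀ σ → σ ⊨ (¿ m) → evalB σ (¿ n) ≡ false
  ¿-exclusive m≢n σ p = ¬true⇒false (λ q → m≢n (≡.trans (≡.sym (¿-sound σ _ p)) (¿-sound σ _ q)))

  infix 25 pc∈_

  pc∈_ : List Label → BExp
  pc∈ []      = NOT always
  pc∈ (m ∷ L) = (¿ m) OR (pc∈ L)

  pc∈-sound : ∀ σ L → σ ⊨ (pc∈ L) → σ pc ∈ L
  pc∈-sound σ (m ∷ L) h with ∨-true⁻ (evalB σ (¿ m)) _ h
  ... | inj₁ p = here (¿-sound σ m p)
  ... | inj₂ p = there (pc∈-sound σ L p)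

  pc∈-complete : ∀ σ L → σ pc ∈ L → σ ⊨ (pc∈ L)
  pc∈-complete σ (m ∷ L) (here p)  = ∨-trueˡ _ (¿-complete σ m p)
  pc∈-complete σ (m ∷ L) (there p) = ∨-trueʳ (evalB σ (¿ m)) (pc∈-complete σ L p)

  pc∈-⊆-annihilates : ∀ {L L' x} → L ⊆ L' → T (pc∈ L') · x ≈ 𝟘 → T (pc∈ L) · x ≈ 𝟘
  pc∈-⊆-annihilates {L} {L'} L⊆L' h =
    ·-congʳ (entails⇒ensures (λ σ p → pc∈-complete σ L' (L⊆L' (pc∈-sound σ L p))))
    ⟫ ·-assoc ⟫ ·-congˡ h ⟫ ·-zeroʳ

  !-ensures : ∀ {m t} → (∀ σ → σ pc ≡ m → σ ⊨ t) → Ensures (!ₖ m) (KB t)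
  !-ensures {m} h = asg-ensures (λ σ → h _ (update-same σ pc m))

  !-ensures-¿ : ∀ {m} → Ensures (!ₖ m) (KB (¿ m))
  !-ensures-¿ {m} = !-ensures (λ σ p → ¿-complete σ m p)

  Within : List Label → BExp → Set
  Within S e = ∀ σ → σ ⊨ e → σ pc ∈ S

  ExitsIn : List Label → Cmd → Set
  ExitsIn L c = ∃[ m ] (m ∈ L × Ensures (KC c) (KB (¿ m)))

  GuardsWithin : List Label → GCs → Set
  GuardsWithin S = AllGC (λ e _ → Within S e)

  BodiesExitIn : List Label → GCs → Set
  BodiesExitIn L = AllGC (λ _ c → ExitsIn L c)

  GuardsWithin-mono : ∀ {S S'} → S ⊆ S' → ∀ g → GuardsWithin S g → GuardsWithin S' g
  GuardsWithin-mono S⊆S' = AllGC-map (λ h σ p → S⊆S' (h σ p))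

  BodiesExitIn-mono : ∀ {L L'} → L ⊆ L' → ∀ g → BodiesExitIn L g → BodiesExitIn L' g
  BodiesExitIn-mono L⊆L' = AllGC-map (λ (m , m∈L , post) → m , L⊆L' m∈L , post)

  Within-enab : ∀ {S} g → GuardsWithin S g → Within S (enab g)
  Within-enab [ e ⇒ c ]   h        = h
  Within-enab (e ⇒ c □ r) (h , hr) σ p with ∨-true⁻ (evalB σ e) _ p
  ... | inj₁ q = h σ q
  ... | inj₂ q = Within-enab r hr σ q

  Within-outside : ∀ {S e} σ → Within S e → σ pc ∉ S → evalB σ e ≡ false
  Within-outside σ h pc∉S = ¬true⇒false (λ q → pc∉S (h σ q))

  GuardsWithin-disabled : ∀ {S t} g → GuardsWithin S g → (∀ σ → σ ⊨ t → σ pc ∉ S) →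
                          T t · KG g ≈ 𝟘
  GuardsWithin-disabled g hg h =
    guards-exclude⇒T·KG≈𝟘 g (AllGC-map (λ {e} w σ p → Within-outside {e = e} σ w (h σ p)) g hg)

  GuardsWithin-enabled : ∀ {S t} g → GuardsWithin S g → (∀ σ → σ pc ∈ S → σ ⊨ t) →
                         T t · KG g ≈ KG g
  GuardsWithin-enabled g hg h = guards-entail⇒T·KG≈KG g (AllGC-map (λ w σ p → h σ (w σ p)) g hg)

  ¿-disables : ∀ {m S} g → GuardsWithin S g → m ∉ S → T (¿ m) · KG g ≈ 𝟘
  ¿-disables {m} {S} g hg m∉S =
    GuardsWithin-disabled g hg (λ σ p pc∈S → m∉S (≡.subst (_∈ S) (¿-sound σ m p) pc∈S))

  !-disables : ∀ {m S} g → GuardsWithin S g → m ∉ S → !ₖ m · KG g ≈ 𝟘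
  !-disables g hg m∉S = ensures-annihilates !-ensures-¿ (¿-disables g hg m∉S)

  BodiesExitIn-ensures : ∀ {L t} g → (∀ σ → σ pc ∈ L → σ ⊨ t) → BodiesExitIn L g →
                         Ensures (KG g) (KB t)
  BodiesExitIn-ensures {L} {t} g h = go g
    where
    exits : ∀ {e c} → ExitsIn L c → Ensures (T e · KC c) (KB t)
    exits {e} {c} (m , m∈L , post) =
      ·-congˡ (post ⟫ ·-congˡ (entails⇒ensures {¿ m} λ σ p → h σ (≡.subst (_∈ L) (≡.sym (¿-sound σ m p)) m∈L))
               ⟫ sym ·-assoc ⟫ ·-congʳ (sym post))
      ⟫ sym ·-assoc
    go : ∀ g → BodiesExitIn L g → Ensures (KG g) (KB t)
    go [ e ⇒ c ]   p        = exits {e} {c} p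
    go (e ⇒ c □ r) (p , pr) = +-cong (exits {e} {c} p) (go r pr) ⟫ sym distribʳ

  BodiesExitIn-avoids : ∀ {L m} g → BodiesExitIn L g → m ∉ L → Ensures (KG g) (KB (NOT (¿ m)))
  BodiesExitIn-avoids {L} {m} g h m∉L = BodiesExitIn-ensures g
    (λ σ p → not-false (¬true⇒false (λ q → m∉L (≡.subst (_∈ L) (¿-sound σ m q) p)))) h

  ¿∧-sound : ∀ {n e} σ → σ ⊨ ((¿ n) AND e) → σ pc ≡ n
  ¿∧-sound {n} σ p = ¿-sound σ n (∧-true⁻ˡ (evalB σ (¿ n)) p)

  heads-within : ∀ n g → GuardsWithin (n ∷ []) (heads n g)
  heads-within n [ e ⇒ d ]   = λ σ p → here (¿∧-sound {n} {e} σ p)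
  heads-within n (e ⇒ d □ r) = (λ σ p → here (¿∧-sound {n} {e} σ p)) , heads-within n r

  heads-exit : ∀ n g → BodiesExitIn (labsG g) (heads n g)
  heads-exit n [ e ⇒ d ]   = lab d , lab∈labs d , !-ensures-¿
  heads-exit n (e ⇒ d □ r) = (lab d , ∈-++⁺ˡ (lab∈labs d) , !-ensures-¿) ,
    BodiesExitIn-mono (∈-++⁺ʳ (labs d)) (heads n r) (heads-exit n r)

  enab-heads : ∀ σ n g → evalB σ (enab (heads n g)) ≡ evalB σ (¿ n) ∧ evalB σ (enab g)
  enab-heads σ n [ e ⇒ d ]   = refl
  enab-heads σ n (e ⇒ d □ r) rewrite enab-heads σ n r =
    ≡.sym (∧-distribˡ-∨ (evalB σ (¿ n)) (evalB σ e) (evalB σ (enab r)))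

  enab-heads⁺ : ∀ σ n g → σ pc ≡ n → σ ⊨ enab g → σ ⊨ enab (heads n g)
  enab-heads⁺ σ n g p q = ≡.trans (enab-heads σ n g) (∧-true (¿-complete σ n p) q)

  ¬¿·heads≈𝟘 : ∀ n g → T (NOT (¿ n)) · KG (heads n g) ≈ 𝟘
  ¬¿·heads≈𝟘 n g = GuardsWithin-disabled (heads n g) (heads-within n g)
    (λ { σ p (here q) → true⇒¬false (¿-complete σ n q) (not-true⁻ p) })

  mutual
    nf-within : ∀ {c f g} → c ▷[ f ] g → GuardsWithin (labs c) g
    nf-within {skip n}       nf-skip   = λ σ p → here (¿-sound σ n p)
    nf-within {assign n x e} nf-assign = λ σ p → here (¿-sound σ n p)
    nf-within {c ︔ d} (nf-seq {g₀ = g₀} {g₁ = g₁} d₀ d₁) =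
      AllGC-□□ g₀ g₁ (GuardsWithin-mono ∈-++⁺ˡ g₀ (nf-within d₀))
                     (GuardsWithin-mono (∈-++⁺ʳ (labs c)) g₁ (nf-within d₁))
    nf-within {ifc n g} (nf-if {gs = gs} br) =
      AllGC-□□ (heads n g) gs (GuardsWithin-mono n∈ (heads n g) (heads-within n g))
        (GuardsWithin-mono there gs (branches-within br))
      where
      n∈ : (n ∷ []) ⊆ (n ∷ labsG g)
      n∈ (here p) = here p
    nf-within {doc n g} (nf-do {gs = gs} br) =
      AllGC-□□ (heads n g) _ (GuardsWithin-mono n∈ (heads n g) (heads-within n g))
        ((λ σ p → here (¿∧-sound {n} {NOT (enab g)} σ p)) ,
         GuardsWithin-mono there gs (branches-within br))
      where
      n∈ : (n ∷ []) ⊆ (n ∷ labsG g)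
      n∈ (here p) = here p

    branches-within : ∀ {f g gs} → Branches f g gs → GuardsWithin (labsG g) gs
    branches-within (br-one dd) = nf-within dd
    branches-within {g = e ⇒ d □ r} (br-cons {g = gd} {gs = gr} dd br) =
      AllGC-□□ gd gr (GuardsWithin-mono ∈-++⁺ˡ gd (nf-within dd))
                     (GuardsWithin-mono (∈-++⁺ʳ (labs d)) gr (branches-within br))

  mutual
    nf-exits : ∀ {c f g} → c ▷[ f ] g → BodiesExitIn (f ∷ labs c) g
    nf-exits nf-skip   = _ , here refl , !-ensures-¿
    nf-exits nf-assign = _ , here refl , (·-congˡ !-ensures-¿ ⟫ sym ·-assoc)
    nf-exits {c ︔ d} {f} (nf-seq {g₀ = g₀} {g₁ = g₁} d₀ d₁) =
      AllGC-□□ g₀ g₁ (BodiesExitIn-mono into-seq₀ g₀ (nf-exits d₀))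
                     (BodiesExitIn-mono into-seq₁ g₁ (nf-exits d₁))
      where
      into-seq₀ : (lab d ∷ labs c) ⊆ (f ∷ labs c ++ labs d)
      into-seq₀ (here refl) = there (∈-++⁺ʳ (labs c) (lab∈labs d))
      into-seq₀ (there p)   = there (∈-++⁺ˡ p)
      into-seq₁ : (f ∷ labs d) ⊆ (f ∷ labs c ++ labs d)
      into-seq₁ (here p)  = here p
      into-seq₁ (there p) = there (∈-++⁺ʳ (labs c) p)
    nf-exits {ifc n g} (nf-if {gs = gs} br) =
      AllGC-□□ (heads n g) gs (BodiesExitIn-mono (λ p → there (there p)) (heads n g) (heads-exit n g))
        (BodiesExitIn-mono (λ { (here p) → here p ; (there p) → there (there p) }) gs
                           (branches-exit br))
    nf-exits {doc n g} (nf-do {gs = gs} br) =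
      AllGC-□□ (heads n g) _ (BodiesExitIn-mono (λ p → there (there p)) (heads n g) (heads-exit n g))
        ((_ , here refl , !-ensures-¿) , BodiesExitIn-mono there gs (branches-exit br))

    branches-exit : ∀ {f g gs} → Branches f g gs → BodiesExitIn (f ∷ labsG g) gs
    branches-exit (br-one dd) = nf-exits dd
    branches-exit {g = e ⇒ d □ r} (br-cons {g = gd} {gs = gr} dd br) =
      AllGC-□□ gd gr
        (BodiesExitIn-mono (λ { (here p) → here p ; (there p) → there (∈-++⁺ˡ p) }) gd (nf-exits dd))
        (BodiesExitIn-mono (λ { (here p) → here p ; (there p) → there (∈-++⁺ʳ (labs d) p) }) gr
                           (branches-exit br))

  -- This is where well-formedness enters: an if with no enabled guard would end the loop.
  mutual
    nf-enabled : ∀ {c f g} → c ▷[ f ] g → WF c → ∀ σ → σ pc ∈ labs c → σ ⊨ enab g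
    nf-enabled {skip n}       nf-skip   _ σ (here p) = ¿-complete σ n p
    nf-enabled {assign n x e} nf-assign _ σ (here p) = ¿-complete σ n p
    nf-enabled {c ︔ d} (nf-seq {g₀ = g₀} {g₁ = g₁} d₀ d₁) (w₀ , w₁) σ p with ∈-++⁻ (labs c) p
    ... | inj₁ q = enab-□□⁺ˡ σ g₀ g₁ (nf-enabled d₀ w₀ σ q)
    ... | inj₂ q = enab-□□⁺ʳ σ g₀ g₁ (nf-enabled d₁ w₁ σ q)
    nf-enabled {ifc n g} (nf-if {gs = gs} br) (total , w) σ (here p) =
      enab-□□⁺ˡ σ (heads n g) gs (enab-heads⁺ σ n g p (total σ))
    nf-enabled {ifc n g} (nf-if {gs = gs} br) (total , w) σ (there q) =
      enab-□□⁺ʳ σ (heads n g) gs (branches-enabled br w σ q)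
    nf-enabled {doc n g} (nf-do br) w σ (here p) with evalB σ (enab g) in eq
    ... | true  = enab-□□⁺ˡ σ (heads n g) _ (enab-heads⁺ σ n g p eq)
    ... | false = enab-□□⁺ʳ σ (heads n g) _ (∨-trueˡ _ (∧-true (¿-complete σ n p) (not-false eq)))
    nf-enabled {doc n g} (nf-do br) w σ (there q) =
      enab-□□⁺ʳ σ (heads n g) _ (∨-trueʳ (evalB σ ((¿ n) AND NOT (enab g))) (branches-enabled br w σ q))

    branches-enabled : ∀ {f g gs} → Branches f g gs → WFG g → ∀ σ → σ pc ∈ labsG g → σ ⊨ enab gs
    branches-enabled (br-one dd) w σ q = nf-enabled dd w σ q
    branches-enabled {g = e ⇒ d □ r} (br-cons {g = gd} {gs = gr} dd br) (w , wr) σ q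
      with ∈-++⁻ (labs d) q
    ... | inj₁ q' = enab-□□⁺ˡ σ gd gr (nf-enabled dd w σ q')
    ... | inj₂ q' = enab-□□⁺ʳ σ gd gr (branches-enabled br wr σ q')

  nf-disabled : ∀ {c f g} → c ▷[ f ] g → ∀ σ → σ pc ∉ labs c → evalB σ (enab g) ≡ false
  nf-disabled {g = g} dd σ = Within-outside {e = enab g} σ (Within-enab g (nf-within dd))

  stop : GCs → KExp
  stop g = T (NOT (enab g))

  Implements : Cmd → Label → GCs → Set
  Implements c f g = (! (lab c) ︔ doc (+ 0) g) ≅ (add c ︔ ! f)

  atomic-implements : ∀ {n f C} → f ≢ n → Ensures C (KB (¿ f)) →
                      !ₖ n · ((T (¿ n) · C) ⋆ · T (NOT (¿ n))) ≈ !ₖ n · C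
  atomic-implements {n} {f} {C} f≢n hC = begin
    !ₖ n · (D ⋆ · ¬N)             ≈⟨ ·-congˡ (·-congʳ (x·x≈𝟘⇒x⋆≈𝟙+x D·D≈𝟘)) ⟩
    !ₖ n · ((𝟙 +ₖ D) · ¬N)        ≈⟨ ·-congˡ (distribʳ ⟫ +-congʳ ·-oneˡ) ⟫ distribˡ ⟩
    !ₖ n · ¬N +ₖ !ₖ n · (D · ¬N)  ≈⟨ +-congʳ (ensures-annihilates !-ensures-¿ t-compl·) ⟩
    𝟘 +ₖ !ₖ n · (D · ¬N)          ≈⟨ +-identityˡ ⟫ ·-congˡ ·-assoc ⟫ sym ·-assoc ⟩
    (!ₖ n · T (¿ n)) · (C · ¬N)   ≈⟨ ·-congʳ (sym !-ensures-¿) ⟫ ·-congˡ C·¬N≈C ⟩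
    !ₖ n · C                      ∎
    where
    D = T (¿ n) · C
    ¬N = T (NOT (¿ n))
    D·D≈𝟘 : D · D ≈ 𝟘
    D·D≈𝟘 = ·-assoc ⟫ ·-congˡ (sym ·-assoc
      ⟫ ·-congʳ (ensures-annihilates hC (exclusive⇒T·T≈𝟘 {¿ f} {¿ n} (¿-exclusive f≢n))) ⟫ ·-zeroˡ)
      ⟫ ·-zeroʳ
    C·¬N≈C : C · ¬N ≈ C
    C·¬N≈C = ·-congʳ hC ⟫ ·-assoc
      ⟫ ·-congˡ (sym (entails⇒ensures {¿ f} {NOT (¿ n)} (λ σ p → not-false (¿-exclusive f≢n σ p))))
      ⟫ sym hC

  seq-implements : ∀ {c d f g₀ g₁} → c ▷[ lab d ] g₀ → d ▷[ f ] g₁ →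
                   Unique (labs c ++ labs d) → f ∉ labs c ++ labs d →
                   Implements c (lab d) g₀ → Implements d f g₁ → Implements (c ︔ d) f (g₀ □□ g₁)
  seq-implements {c} {d} {f} {g₀} {g₁} d₀ d₁ u f∉ impl₀ impl₁ = begin
    !ₖ (lab c) · (KG (g₀ □□ g₁) ⋆ · stop (g₀ □□ g₁))
      ≈⟨ ·-congˡ (·-cong (⋆-cong (KG-□□ g₀ g₁)) stop-□□) ⟩
    !ₖ (lab c) · ((G₀ +ₖ G₁) ⋆ · (stop g₀ · stop g₁))
      ≈⟨ ·-congˡ (·-congʳ (y·x≈𝟘⇒[x+y]⋆≈x⋆·y⋆ G₁·G₀≈𝟘)) ⟩
    !ₖ (lab c) · ((G₀ ⋆ · G₁ ⋆) · (stop g₀ · stop g₁))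
      ≈⟨ ·-congˡ (·-assoc ⟫ ·-congˡ (sym ·-assoc ⟫ ·-congʳ (sym (·-comm⇒·⋆-comm stop₀-commutes)))) ⟩
    !ₖ (lab c) · (G₀ ⋆ · ((stop g₀ · G₁ ⋆) · stop g₁))
      ≈⟨ ·-congˡ (·-congˡ ·-assoc ⟫ sym ·-assoc) ⟫ sym ·-assoc ⟩
    (!ₖ (lab c) · (G₀ ⋆ · stop g₀)) · (G₁ ⋆ · stop g₁)
      ≈⟨ ·-congʳ impl₀ ⟫ ·-assoc ⟩
    KC (add c) · (!ₖ (lab d) · (G₁ ⋆ · stop g₁))
      ≈⟨ ·-congˡ impl₁ ⟫ sym ·-assoc ⟩
    (KC (add c) · KC (add d)) · !ₖ f ∎
    where
    G₀ = KG g₀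
    G₁ = KG g₁
    stop-□□ : stop (g₀ □□ g₁) ≈ stop g₀ · stop g₁
    stop-□□ = equivalent⇒T≈T {NOT (enab (g₀ □□ g₁))} {NOT (enab g₀) AND NOT (enab g₁)}
      (λ σ → ≡.trans (≡.cong not (enab-□□ σ g₀ g₁)) (deMorgan₂ (evalB σ (enab g₀)) (evalB σ (enab g₁))))
      ⟫ t-and
    d-stops-g₀ : ∀ σ → σ pc ∈ labs d → σ ⊨ NOT (enab g₀)
    d-stops-g₀ σ q = not-false (nf-disabled d₀ σ (λ p → Unique-++⇒Disjoint (labs c) u (p , q)))
    G₁-stops-g₀ : Ensures G₁ (KB (NOT (enab g₀)))
    G₁-stops-g₀ = BodiesExitIn-ensures g₁
      (λ { σ (here p)  → not-false (nf-disabled d₀ σ (λ q → f∉ (∈-++⁺ˡ (≡.subst (_∈ labs c) p q))))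
         ; σ (there q) → d-stops-g₀ σ q })
      (nf-exits d₁)
    G₁·G₀≈𝟘 : G₁ · G₀ ≈ 𝟘
    G₁·G₀≈𝟘 = ensures-annihilates G₁-stops-g₀ (¬enab·KG≈𝟘 g₀)
    stop₀-commutes : stop g₀ · G₁ ≈ G₁ · stop g₀
    stop₀-commutes = GuardsWithin-enabled g₁ (nf-within d₁) d-stops-g₀ ⟫ G₁-stops-g₀

  implements-in-context : ∀ {d f gd W R t} → d ▷[ f ] gd → Implements d f gd →
    W ≈ KG gd +ₖ R → T (pc∈ (f ∷ labs d)) · R ≈ 𝟘 →
    (∀ σ → σ pc ∈ labs d → evalB σ t ≡ false) → (∀ σ → σ pc ≡ f → σ ⊨ t) →
    !ₖ (lab d) · (W ⋆ · T t) ≈ KC (add d) · !ₖ f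
  implements-in-context {d} {f} {gd} {W} {R} {t} dd impl hW hR inside at-f = begin
    !ₖ (lab d) · (W ⋆ · T t)
      ≈⟨ sym ·-assoc ⟫ ·-congʳ (⋆-drop-disabled start-in end-in hW hR) ⟩
    (!ₖ (lab d) · KG gd ⋆) · T t
      ≈⟨ ·-congˡ t≈stop·t ⟫ sym ·-assoc ⟫ ·-congʳ ·-assoc ⟩
    (!ₖ (lab d) · (KG gd ⋆ · stop gd)) · T t
      ≈⟨ ·-congʳ impl ⟫ ·-assoc ⟩
    KC (add d) · (!ₖ f · T t)
      ≈⟨ ·-congˡ (sym (!-ensures at-f)) ⟩
    KC (add d) · !ₖ f ∎
    where
    start-in : Ensures (!ₖ (lab d)) (KB (pc∈ (f ∷ labs d)))
    start-in = !-ensures (λ σ p → pc∈-complete σ _ (there (≡.subst (_∈ labs d) (≡.sym p) (lab∈labs d))))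
    end-in : Ensures (KG gd) (KB (pc∈ (f ∷ labs d)))
    end-in = BodiesExitIn-ensures gd (λ σ p → pc∈-complete σ _ p) (nf-exits dd)
    t≈stop·t : T t ≈ stop gd · T t
    t≈stop·t = sym (entails⇒absorbs {t} {NOT (enab gd)}
      (λ σ p → not-false (nf-disabled dd σ (λ q → true⇒¬false p (inside σ q)))))

  branchBodies : Label → Label → GCs → KExp
  branchBodies n f [ e ⇒ d ]   = T ((¿ n) AND e) · (KC (add d) · !ₖ f)
  branchBodies n f (e ⇒ d □ r) = T ((¿ n) AND e) · (KC (add d) · !ₖ f) +ₖ branchBodies n f r

  branchBodies-if : ∀ n f g → branchBodies n f g ≈ T (¿ n) · (KG (addIf g) · !ₖ f)
  branchBodies-if n f [ e ⇒ d ]   = ·-congʳ t-and ⟫ ·-assoc ⟫ ·-congˡ (sym ·-assoc)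
  branchBodies-if n f (e ⇒ d □ r) =
    +-cong (·-congʳ t-and ⟫ ·-assoc ⟫ ·-congˡ (sym ·-assoc)) (branchBodies-if n f r)
    ⟫ sym distribˡ ⟫ ·-congˡ (sym distribʳ)

  branchBodies-do : ∀ n g → branchBodies n n g ≈ T (¿ n) · KG (addDo n g)
  branchBodies-do n [ e ⇒ d ]   = ·-congʳ t-and ⟫ ·-assoc
  branchBodies-do n (e ⇒ d □ r) = +-cong (·-congʳ t-and ⟫ ·-assoc) (branchBodies-do n r) ⟫ sym distribˡ

  -- The loop W may also run guarded commands R of the surrounding program; they
  -- are harmless as long as they are disabled while pc lies in g or equals f.
  BranchesImplement : Label → GCs → GCs → Set
  BranchesImplement f g gs = ∀ {n W R t} → W ≈ KG gs +ₖ R → T (pc∈ (f ∷ labsG g)) · R ≈ 𝟘 →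
    (∀ σ → σ pc ∈ labsG g → evalB σ t ≡ false) → (∀ σ → σ pc ≡ f → σ ⊨ t) →
    KG (heads n g) · (W ⋆ · T t) ≈ branchBodies n f g

  branches-implement-one : ∀ {f e d gd} → d ▷[ f ] gd → Implements d f gd →
                           BranchesImplement f [ e ⇒ d ] gd
  branches-implement-one dd impl hW hR inside at-f =
    ·-assoc ⟫ ·-congˡ (implements-in-context dd impl hW hR inside at-f)

  branches-implement-cons : ∀ {f e d r gd gr} → d ▷[ f ] gd → Branches f r gr →
    Unique (labs d ++ labsG r) → f ∉ labs d ++ labsG r →
    Implements d f gd → BranchesImplement f r gr → BranchesImplement f (e ⇒ d □ r) (gd □□ gr)
  branches-implement-cons {f} {e} {d} {r} {gd} {gr} dd br u f∉ impl-d impl-r {n} {W} {R} {t}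
                          hW hR inside at-f =
    distribʳ ⟫ +-cong
      (·-assoc ⟫ ·-congˡ (implements-in-context {R = KG gr +ₖ R} {t = t} dd impl-d
        (hW ⟫ +-congʳ (KG-□□ gd gr) ⟫ +-assoc)
        (distribˡ ⟫ +-cong (GuardsWithin-disabled gr (branches-within br) d-excludes-r)
                           (pc∈-⊆-annihilates (into-dr ∈-++⁺ˡ) hR) ⟫ +-zero)
        (λ σ q → inside σ (∈-++⁺ˡ q)) at-f))
      (impl-r {n} {W} {KG gd +ₖ R} {t}
        (hW ⟫ +-congʳ (KG-□□ gd gr ⟫ +-comm) ⟫ +-assoc)
        (distribˡ ⟫ +-cong (GuardsWithin-disabled gd (nf-within dd) r-excludes-d)
                           (pc∈-⊆-annihilates (into-dr (∈-++⁺ʳ (labs d))) hR) ⟫ +-zero)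
        (λ σ q → inside σ (∈-++⁺ʳ (labs d) q)) at-f)
    where
    into-dr : ∀ {L} → L ⊆ labs d ++ labsG r → (f ∷ L) ⊆ (f ∷ labs d ++ labsG r)
    into-dr L⊆ (here p)  = here p
    into-dr L⊆ (there p) = there (L⊆ p)
    d-excludes-r : ∀ σ → σ ⊨ pc∈ (f ∷ labs d) → σ pc ∉ labsG r
    d-excludes-r σ p q with pc∈-sound σ (f ∷ labs d) p
    ... | here pc≡f = f∉ (∈-++⁺ʳ (labs d) (≡.subst (_∈ labsG r) pc≡f q))
    ... | there q'  = Unique-++⇒Disjoint (labs d) u (q' , q)
    r-excludes-d : ∀ σ → σ ⊨ pc∈ (f ∷ labsG r) → σ pc ∉ labs d
    r-excludes-d σ p q with pc∈-sound σ (f ∷ labsG r) p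
    ... | here pc≡f = f∉ (∈-++⁺ˡ (≡.subst (_∈ labs d) pc≡f q))
    ... | there q'  = Unique-++⇒Disjoint (labs d) u (q , q')

  if-implements : ∀ {n g f gs} → Branches f g gs → WF (ifc n g) →
                  Unique (n ∷ labsG g) → f ∉ n ∷ labsG g →
                  BranchesImplement f g gs → Implements (ifc n g) f (heads n g □□ gs)
  if-implements {n} {g} {f} {gs} br wf u f∉ bodies = begin
    !ₖ n · (KG whole ⋆ · stop whole)
      ≈⟨ sym ·-assoc ⟫ ·-congʳ (·-congˡ (⋆-cong (KG-□□ (heads n g) gs))) ⟩
    (!ₖ n · (H +ₖ G) ⋆) · stop whole
      ≈⟨ ·-congʳ (⋆-denest n·G≈𝟘 ⟫ ·-congˡ (x·x≈𝟘⇒x⋆≈𝟙+x HG⋆·HG⋆≈𝟘)) ⟩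
    (!ₖ n · (𝟙 +ₖ H · G ⋆)) · stop whole
      ≈⟨ ·-congʳ (distribˡ ⟫ +-congʳ ·-oneʳ) ⟫ distribʳ ⟩
    !ₖ n · stop whole +ₖ (!ₖ n · (H · G ⋆)) · stop whole
      ≈⟨ +-congʳ n·stop≈𝟘 ⟫ +-identityˡ ⟩
    (!ₖ n · (H · G ⋆)) · stop whole
      ≈⟨ ·-assoc ⟫ ·-congˡ (·-assoc ⟫ bodies {n} {G} {𝟘} {NOT (enab whole)} (sym +-zero) ·-zeroʳ
                                        inside at-f ⟫ branchBodies-if n f g) ⟩
    !ₖ n · (T (¿ n) · (KG (addIf g) · !ₖ f))
      ≈⟨ sym ·-assoc ⟫ ·-congʳ (sym !-ensures-¿) ⟫ sym ·-assoc ⟩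
    (!ₖ n · KG (addIf g)) · !ₖ f ∎
    where
    whole = heads n g □□ gs
    H = KG (heads n g)
    G = KG gs
    n∉g : n ∉ labsG g
    n∉g = Unique[x∷xs]⇒x∉xs u
    n∉fg : n ∉ f ∷ labsG g
    n∉fg (here n≡f) = f∉ (here (≡.sym n≡f))
    n∉fg (there p)  = n∉g p
    n·G≈𝟘 : !ₖ n · G ≈ 𝟘
    n·G≈𝟘 = !-disables gs (branches-within br) n∉g
    H·H≈𝟘 : H · H ≈ 𝟘
    H·H≈𝟘 = ensures-annihilates (BodiesExitIn-avoids (heads n g) (heads-exit n g) n∉g) (¬¿·heads≈𝟘 n g)
    G·H≈𝟘 : G · H ≈ 𝟘
    G·H≈𝟘 = ensures-annihilates (BodiesExitIn-avoids gs (branches-exit br) n∉fg) (¬¿·heads≈𝟘 n g)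
    HG⋆·HG⋆≈𝟘 : (H · G ⋆) · (H · G ⋆) ≈ 𝟘
    HG⋆·HG⋆≈𝟘 = ·-assoc ⟫ ·-congˡ (sym ·-assoc ⟫ ·-congʳ (x·y≈𝟘⇒x⋆·y≈y G·H≈𝟘))
      ⟫ sym ·-assoc ⟫ ·-congʳ H·H≈𝟘 ⟫ ·-zeroˡ
    inside : ∀ σ → σ pc ∈ labsG g → evalB σ (NOT (enab whole)) ≡ false
    inside σ q = not-true (nf-enabled (nf-if br) wf σ (there q))
    at-f : ∀ σ → σ pc ≡ f → σ ⊨ NOT (enab whole)
    at-f σ p = not-false (nf-disabled (nf-if br) σ (λ q → f∉ (≡.subst (_∈ n ∷ labsG g) p q)))
    n·stop≈𝟘 : !ₖ n · stop whole ≈ 𝟘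
    n·stop≈𝟘 = ensures-annihilates !-ensures-¿ (exclusive⇒T·T≈𝟘 {¿ n} {NOT (enab whole)}
      (λ σ p → not-true (nf-enabled (nf-if br) wf σ (here (¿-sound σ n p)))))

  exitGuard : Label → GCs → BExp
  exitGuard n g = (¿ n) AND NOT (enab g)

  doNF : Label → GCs → Label → GCs → GCs
  doNF n g f gs = heads n g □□ (exitGuard n g ⇒ ! f □ gs)

  addDo-ensures-¿ : ∀ n g → Ensures (KG (addDo n g)) (KB (¿ n))
  addDo-ensures-¿ n [ e ⇒ d ]   = ·-congˡ (·-congˡ !-ensures-¿ ⟫ sym ·-assoc) ⟫ sym ·-assoc
  addDo-ensures-¿ n (e ⇒ d □ r) =
    +-cong (·-congˡ (·-congˡ !-ensures-¿ ⟫ sym ·-assoc) ⟫ sym ·-assoc) (addDo-ensures-¿ n r)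
    ⟫ sym distribʳ

  enab-addDo : ∀ n g → enab (addDo n g) ≡ enab g
  enab-addDo n [ e ⇒ d ]   = refl
  enab-addDo n (e ⇒ d □ r) = ≡.cong (e OR_) (enab-addDo n r)

  stop-addDo : ∀ n g → stop g ≈ stop (addDo n g)
  stop-addDo n g = ≡⇒≈ (≡.cong (λ e → T (NOT e)) (≡.sym (enab-addDo n g)))

  -- The exit branch fires at most once and nothing can follow it, and no branch
  -- of gs can fire before one of the heads has.
  do-unroll : ∀ {n g f gs} → Branches n g gs → Unique (n ∷ labsG g) → f ∉ n ∷ labsG g →
    !ₖ n · KG (doNF n g f gs) ⋆
      ≈ !ₖ n · ((KG (heads n g) · KG gs ⋆) ⋆ · (𝟙 +ₖ T (exitGuard n g) · !ₖ f))
  do-unroll {n} {g} {f} {gs} br u f∉ = begin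
    !ₖ n · KG (doNF n g f gs) ⋆
      ≈⟨ ·-congˡ (⋆-cong (KG-□□ (heads n g) (exitGuard n g ⇒ ! f □ gs) ⟫ sym +-assoc)) ⟩
    !ₖ n · ((H +ₖ X) +ₖ G) ⋆
      ≈⟨ ⋆-denest n·G≈𝟘 ⟩
    !ₖ n · ((H +ₖ X) · G ⋆) ⋆
      ≈⟨ ·-congˡ (⋆-cong (distribʳ ⟫ +-congˡ (x·y≈𝟘⇒x·y⋆≈x X·G≈𝟘))) ⟩
    !ₖ n · (H · G ⋆ +ₖ X) ⋆
      ≈⟨ ·-congˡ (y·x≈𝟘⇒[x+y]⋆≈x⋆·y⋆ X·HG⋆≈𝟘 ⟫ ·-congˡ (x·x≈𝟘⇒x⋆≈𝟙+x X·X≈𝟘)) ⟩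
    !ₖ n · ((H · G ⋆) ⋆ · (𝟙 +ₖ X))  ∎
    where
    H = KG (heads n g)
    G = KG gs
    X = T (exitGuard n g) · !ₖ f
    n·G≈𝟘 : !ₖ n · G ≈ 𝟘
    n·G≈𝟘 = !-disables gs (branches-within br) (Unique[x∷xs]⇒x∉xs u)
    X·G≈𝟘 : X · G ≈ 𝟘
    X·G≈𝟘 = ·-assoc ⟫ ·-congˡ (!-disables gs (branches-within br) (λ p → f∉ (there p))) ⟫ ·-zeroʳ
    f·H≈𝟘 : !ₖ f · H ≈ 𝟘
    f·H≈𝟘 = !-disables (heads n g) (heads-within n g) λ { (here f≡n) → f∉ (here f≡n) }
    X·HG⋆≈𝟘 : X · (H · G ⋆) ≈ 𝟘
    X·HG⋆≈𝟘 = sym ·-assoc ⟫ ·-congʳ (·-assoc ⟫ ·-congˡ f·H≈𝟘 ⟫ ·-zeroʳ) ⟫ ·-zeroˡ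
    f-excludes-exit : ∀ σ → σ ⊨ ¿ f → evalB σ (exitGuard n g) ≡ false
    f-excludes-exit σ p = ¬true⇒false (λ q →
      f∉ (here (≡.trans (≡.sym (¿-sound σ f p)) (¿∧-sound {n} {NOT (enab g)} σ q))))
    X·X≈𝟘 : X · X ≈ 𝟘
    X·X≈𝟘 = ·-assoc ⟫ ·-congˡ (ensures-annihilates !-ensures-¿
      (sym ·-assoc ⟫ ·-congʳ (exclusive⇒T·T≈𝟘 {¿ f} {exitGuard n g} f-excludes-exit) ⟫ ·-zeroˡ))
      ⟫ ·-zeroʳ

  do-iterations-start-at-n : ∀ {n g f gs} → Branches n g gs → WFG g → Unique (n ∷ labsG g) →
    let HG⋆ = KG (heads n g) · KG gs ⋆
        F = (𝟙 +ₖ T (exitGuard n g) · !ₖ f) · stop (doNF n g f gs)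
    in HG⋆ ⋆ · F ≈ (HG⋆ · T (¿ n)) ⋆ · F
  do-iterations-start-at-n {n} {g} {f} {gs} br wg u =
    ⋆-insert-test (ensures-insert-test HG⋆-ensures-s s¬N·F≈𝟘)
                  (ensures-insert-test HG⋆-ensures-s s¬N·HG⋆≈𝟘)
    where
    H = KG (heads n g)
    G = KG gs
    s = pc∈ (n ∷ labsG g)
    HG⋆-ensures-s : Ensures (H · G ⋆) (KB s)
    HG⋆-ensures-s = ·⋆-ensures
      (BodiesExitIn-ensures (heads n g) (λ σ p → pc∈-complete σ _ (there p)) (heads-exit n g))
      (BodiesExitIn-ensures gs (λ σ p → pc∈-complete σ _ p) (branches-exit br))
    s¬N·HG⋆≈𝟘 : (T s · T (NOT (¿ n))) · (H · G ⋆) ≈ 𝟘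
    s¬N·HG⋆≈𝟘 = ·-assoc ⟫ ·-congˡ (sym ·-assoc ⟫ ·-congʳ (¬¿·heads≈𝟘 n g) ⟫ ·-zeroˡ) ⟫ ·-zeroʳ
    s¬N-excludes-stop : ∀ σ → σ ⊨ s AND NOT (¿ n) → evalB σ (NOT (enab (doNF n g f gs))) ≡ false
    s¬N-excludes-stop σ p with pc∈-sound σ (n ∷ labsG g) (∧-true⁻ˡ (evalB σ s) p)
    ... | here pc≡n =
      ⊥-elim (true⇒¬false (¿-complete σ n pc≡n) (not-true⁻ (∧-true⁻ʳ (evalB σ s) p)))
    ... | there q = not-true (nf-enabled (nf-do br) wg σ (there q))
    ¬N-excludes-exit : ∀ σ → σ ⊨ NOT (¿ n) → evalB σ (exitGuard n g) ≡ false
    ¬N-excludes-exit σ p =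
      ¬true⇒false (λ q → true⇒¬false (∧-true⁻ˡ (evalB σ (¿ n)) q) (not-true⁻ p))
    s¬N·X≈𝟘 : (T s · T (NOT (¿ n))) · (T (exitGuard n g) · !ₖ f) ≈ 𝟘
    s¬N·X≈𝟘 = ·-assoc ⟫ ·-congˡ (sym ·-assoc
      ⟫ ·-congʳ (exclusive⇒T·T≈𝟘 {NOT (¿ n)} {exitGuard n g} ¬N-excludes-exit) ⟫ ·-zeroˡ)
      ⟫ ·-zeroʳ
    s¬N·F≈𝟘 : (T s · T (NOT (¿ n))) · ((𝟙 +ₖ T (exitGuard n g) · !ₖ f) · stop (doNF n g f gs)) ≈ 𝟘
    s¬N·F≈𝟘 = ·-congˡ (distribʳ ⟫ +-congʳ ·-oneˡ) ⟫ distribˡ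
      ⟫ +-cong (·-congʳ (sym t-and) ⟫ exclusive⇒T·T≈𝟘 {s AND NOT (¿ n)} s¬N-excludes-stop)
               (sym ·-assoc ⟫ ·-congʳ s¬N·X≈𝟘 ⟫ ·-zeroˡ)
      ⟫ +-zero

  do-exit : ∀ {n g f gs} → Branches n g gs → WFG g → f ∉ n ∷ labsG g →
    T (¿ n) · ((𝟙 +ₖ T (exitGuard n g) · !ₖ f) · stop (doNF n g f gs)) ≈ T (¿ n) · (stop g · !ₖ f)
  do-exit {n} {g} {f} {gs} br wg f∉ = begin
    N · ((𝟙 +ₖ X · !ₖ f) · stop whole)
      ≈⟨ ·-congˡ (distribʳ ⟫ +-congʳ ·-oneˡ) ⟫ distribˡ ⟩
    N · stop whole +ₖ N · ((X · !ₖ f) · stop whole)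
      ≈⟨ +-congʳ N·stop≈𝟘 ⟫ +-identityˡ ⟩
    N · ((X · !ₖ f) · stop whole)
      ≈⟨ ·-congˡ (·-assoc ⟫ ·-congˡ (sym (!-ensures at-f))) ⟩
    N · (X · !ₖ f)
      ≈⟨ sym ·-assoc ⟫ ·-congʳ (·-congˡ t-and ⟫ sym ·-assoc ⟫ ·-congʳ t-idem) ⟩
    (N · stop g) · !ₖ f
      ≈⟨ ·-assoc ⟩
    N · (stop g · !ₖ f) ∎
    where
    whole = doNF n g f gs
    N = T (¿ n)
    X = T (exitGuard n g)
    N·stop≈𝟘 : N · stop whole ≈ 𝟘
    N·stop≈𝟘 = exclusive⇒T·T≈𝟘 {¿ n} {NOT (enab whole)}
      (λ σ p → not-true (nf-enabled (nf-do br) wg σ (here (¿-sound σ n p))))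
    at-f : ∀ σ → σ pc ≡ f → σ ⊨ NOT (enab whole)
    at-f σ p = not-false (nf-disabled (nf-do br) σ (λ q → f∉ (≡.subst (_∈ n ∷ labsG g) p q)))

  do-implements : ∀ {n g f gs} → Branches n g gs → WF (doc n g) →
                  Unique (n ∷ labsG g) → f ∉ n ∷ labsG g → BranchesImplement n g gs →
                  Implements (doc n g) f (doNF n g f gs)
  do-implements {n} {g} {f} {gs} br wg u f∉ bodies = begin
    !ₖ n · (KG (doNF n g f gs) ⋆ · stop (doNF n g f gs))
      ≈⟨ sym ·-assoc ⟫ ·-congʳ (do-unroll br u f∉) ⟫ ·-assoc ⟫ ·-congˡ ·-assoc ⟩
    !ₖ n · ((H · G ⋆) ⋆ · F)
      ≈⟨ ·-congˡ (do-iterations-start-at-n br wg u) ⟩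
    !ₖ n · ((H · G ⋆ · N) ⋆ · F)
      ≈⟨ ·-congˡ (·-congʳ (⋆-cong (·-assoc ⟫ branch-bodies ⟫ branchBodies-do n g))) ⟩
    !ₖ n · ((N · Q) ⋆ · F)
      ≈⟨ sym ·-assoc ⟫ ·-congʳ (⋆-drop-test !-ensures-¿ (addDo-ensures-¿ n g)) ⟩
    (!ₖ n · Q ⋆) · F
      ≈⟨ ·-congʳ loop-ends-at-n ⟫ ·-assoc ⟩
    (!ₖ n · Q ⋆) · (N · F)
      ≈⟨ ·-congˡ (do-exit br wg f∉) ⟫ sym ·-assoc ⟫ ·-congʳ (sym loop-ends-at-n) ⟩
    (!ₖ n · Q ⋆) · (stop g · !ₖ f)
      ≈⟨ sym ·-assoc ⟫ ·-congʳ (·-assoc ⟫ ·-congˡ (·-congˡ (stop-addDo n g))) ⟩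
    (!ₖ n · (Q ⋆ · stop (addDo n g))) · !ₖ f ∎
    where
    H = KG (heads n g)
    G = KG gs
    N = T (¿ n)
    Q = KG (addDo n g)
    F = (𝟙 +ₖ T (exitGuard n g) · !ₖ f) · stop (doNF n g f gs)
    inside : ∀ σ → σ pc ∈ labsG g → evalB σ (¿ n) ≡ false
    inside σ q = ¬true⇒false (λ p → Unique[x∷xs]⇒x∉xs u (≡.subst (_∈ labsG g) (¿-sound σ n p) q))
    branch-bodies : H · (G ⋆ · N) ≈ branchBodies n n g
    branch-bodies = bodies {n} {G} {𝟘} {¿ n} (sym +-zero) ·-zeroʳ inside (λ σ → ¿-complete σ n)
    loop-ends-at-n : Ensures (!ₖ n · Q ⋆) (KB (¿ n))
    loop-ends-at-n = ·⋆-ensures !-ensures-¿ (addDo-ensures-¿ n g)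

  mutual
    nf-implements : ∀ {c f g} → c ▷[ f ] g → WF c → Unique (labs c) → f ∉ labs c → Implements c f g
    nf-implements nf-skip _ _ f∉ =
      atomic-implements (λ f≡n → f∉ (here f≡n)) !-ensures-¿ ⟫ ·-congʳ (sym ·-oneʳ)
    nf-implements nf-assign _ _ f∉ =
      atomic-implements (λ f≡n → f∉ (here f≡n)) (·-congˡ !-ensures-¿ ⟫ sym ·-assoc) ⟫ sym ·-assoc
    nf-implements {c ︔ d} (nf-seq d₀ d₁) (w₀ , w₁) u f∉ = seq-implements d₀ d₁ u f∉
      (nf-implements d₀ w₀ (Unique-++⁻ˡ (labs c) u)
                     (λ p → Unique-++⇒Disjoint (labs c) u (p , lab∈labs d)))
      (nf-implements d₁ w₁ (Unique-++⁻ʳ (labs c) u) (λ p → f∉ (∈-++⁺ʳ (labs c) p)))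
    nf-implements (nf-if br) wf@(_ , w) u@(_ ∷ u') f∉ =
      if-implements br wf u f∉ (branches-implement br w u' (λ p → f∉ (there p)))
    nf-implements (nf-do br) w u@(_ ∷ u') f∉ =
      do-implements br w u f∉ (branches-implement br w u' (Unique[x∷xs]⇒x∉xs u))

    branches-implement : ∀ {f g gs} → Branches f g gs → WFG g → Unique (labsG g) → f ∉ labsG g →
                         BranchesImplement f g gs
    branches-implement (br-one dd) w u f∉ = branches-implement-one dd (nf-implements dd w u f∉)
    branches-implement {g = e ⇒ d □ r} (br-cons dd br) (w , wr) u f∉ =
      branches-implement-cons dd br u f∉
      (nf-implements dd w (Unique-++⁻ˡ (labs d) u) (λ p → f∉ (∈-++⁺ˡ p)))
      (branches-implement br wr (Unique-++⁻ʳ (labs d) u) (λ p → f∉ (∈-++⁺ʳ (labs d) p)))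

theorem5p22 : (pc : Var) (c : Cmd) (f : Label) (gcs : GCs) →
    WF c → okf c f → pc ∉ vars c → PC._▷[_]_ pc c f gcs →
    (assign (+ 0) pc (const (lab c)) ︔ doc (+ 0) gcs)
      ≅ (PC.add pc c ︔ PC.!_ pc f)
theorem5p22 pc c f gcs wf (_ , unique , f∉) _ nf = nf-implements nf wf unique f∉
  where open ProgramCounter pc
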